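{- Let $t\ge 3$ be a prime and let $\sigma$ be a generator of $\mathrm{Gal}(\mathbb{F}_{q^t}/\mathbb{F}_q)$, inducing the collineation $\hat\sigma:\langle(x_1,\ldots,x_t)\rangle_{q^t}\mapsto\langle(x_1^\sigma,\ldots,x_t^\sigma)\rangle_{q^t}$ of $\mathrm{PG}(t-1,q^t)$. Let $Q_1,Q_2$ be two distinct $\mathbb{F}_q$-rational points of $\mathrm{PG}(t-1,q^t)$ and let $P$ be an imaginary point. Then no $t$ of the points $Q_1,Q_2,P,P^{\hat\sigma},\ldots,P^{\hat\sigma^{t-1}}$ lie on a hyperplane.
   Context: A point of $\mathrm{PG}(t-1,q^t)$ is $\mathbb{F}_q$-rational if it has homogeneous coordinates all in $\mathbb{F}_q$. A point $P$ is imaginary if $\langle P,P^{\hat\sigma},\ldots,P^{\hat\sigma^{t-1}}\rangle=\mathrm{PG}(t-1,q^t)$ (equivalently, its coordinates $\alpha_1,\ldots,\alpha_t$ are $\mathbb{F}_q$-linearly independent). -}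

module Defs where

open import Level using (0ℓ)
open import Data.Nat as ℕ using (ℕ; zero; suc)
open import Data.Fin using (Fin; zero; suc; toℕ)
open import Data.Product using (Σ; ∃; _×_; _,_)
open import Relation.Binary.PropositionalEquality using (_≡_; _≢_)
open import Relation.Nullary using (¬_)
open import Algebra.Structures using (IsCommutativeRing)
open import Function.Bundles using (_↔_)

record Field : Set₁ where
  infixl 6 _+_
  infixl 7 _*_
  field
    Carrier : Set
    _+_ _*_ : Carrier → Carrier → Carrier
    -_      : Carrier → Carrier
    0# 1#   : Carrier
    isCommutativeRing : IsCommutativeRing _≡_ _+_ _*_ -_ 0# 1#
    0≢1     : 0# ≢ 1#
    inverse : ∀ x → x ≢ 0# → ∃ λ y → x * y ≡ 1#

open Field

HasSize : Field → ℕ → Set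
HasSize F n = Carrier F ↔ Fin n

-- A field embedding K ↪ L (ring homomorphism; injective automatically).
record Embedding (K L : Field) : Set where
  field
    map     : Carrier K → Carrier L
    map-+   : ∀ x y → map (_+_ K x y) ≡ _+_ L (map x) (map y)
    map-*   : ∀ x y → map (_*_ K x y) ≡ _*_ L (map x) (map y)
    map-1   : map (1# K) ≡ 1# L

record Automorphism (L : Field) : Set where
  field
    fun     : Carrier L → Carrier L
    inv     : Carrier L → Carrier L
    inv-l   : ∀ x → inv (fun x) ≡ x
    inv-r   : ∀ x → fun (inv x) ≡ x
    fun-+   : ∀ x y → fun (_+_ L x y) ≡ _+_ L (fun x) (fun y)
    fun-*   : ∀ x y → fun (_*_ L x y) ≡ _*_ L (fun x) (fun y)

iter : {A : Set} → ℕ → (A → A) → A → A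
iter zero    f x = x
iter (suc n) f x = f (iter n f x)

FixesBase : {K L : Field} → Embedding K L → Automorphism L → Set
FixesBase {K} ι τ = ∀ (a : Carrier K) → Automorphism.fun τ (Embedding.map ι a) ≡ Embedding.map ι a

IsGaloisGenerator : {K L : Field} → Embedding K L → Automorphism L → Set
IsGaloisGenerator {K} {L} ι σ =
  FixesBase ι σ ×
  (∀ (τ : Automorphism L) → FixesBase ι τ →
     ∃ λ (i : ℕ) → ∀ x → Automorphism.fun τ x ≡ iter i (Automorphism.fun σ) x)

module Geometry (L : Field) where
  F = Carrier L

  -- vectors of F^t (homogeneous coordinates of points of PG(t-1, F))
  Vec : ℕ → Set
  Vec t = Fin t → F

  Σ[_] : {t : ℕ} → (Fin t → F) → F
  Σ[_] {zero}  f = 0# L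
  Σ[_] {suc t} f = _+_ L (f zero) (Σ[_] (λ i → f (suc i)))

  Nonzero : {t : ℕ} → Vec t → Set
  Nonzero v = ¬ (∀ i → v i ≡ 0# L)

  SamePoint : {t : ℕ} → Vec t → Vec t → Set
  SamePoint v w = ∃ λ c → (c ≢ 0# L) × (∀ i → v i ≡ _*_ L c (w i))

  InSpan : {t m : ℕ} → (Fin m → Vec t) → Vec t → Set
  InSpan {t} {m} u v = ∃ λ (c : Fin m → F) → ∀ i → v i ≡ Σ[ (λ j → _*_ L (c j) (u j i)) ]

  _^[_] : {t : ℕ} → Vec t → (F → F) → Vec t
  (v ^[ f ]) i = f (v i)

  OnHyperplane : {t : ℕ} → Vec t → Vec t → Set
  OnHyperplane a v = Σ[ (λ i → _*_ L (a i) (v i)) ] ≡ 0# L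

open Geometry public

module Rational {K L : Field} (ι : Embedding K L) where
  IsRational : {t : ℕ} → (Fin t → Carrier L) → Set
  IsRational {t} v = ∃ λ (w : Fin t → Carrier K) → SamePoint L v (λ i → Embedding.map ι (w i))

open Rational public

module Imaginary {L : Field} (σ : Automorphism L) where
  conj : {t : ℕ} → ℕ → Vec L t → Vec L t
  conj i v = _^[_] L v (iter i (Automorphism.fun σ))

  -- ⟨P, P^σ̂, …, P^{σ̂^{t-1}}⟩ = PG(t-1, q^t): every vector lies in their span
  IsImaginary : {t : ℕ} → Vec L t → Set
  IsImaginary {t} v = ∀ (w : Vec L t) → InSpan L (λ (j : Fin t) → conj (toℕ j) v) w

  pointList : {t : ℕ} → Vec L t → Vec L t → Vec L t → Fin (suc (suc t)) → Vec L t
  pointList Q₁ Q₂ P zero = Q₁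
  pointList Q₁ Q₂ P (suc zero) = Q₂
  pointList Q₁ Q₂ P (suc (suc j)) = conj (toℕ j) P

open Imaginary public

module Submission where

-- Let K ⊆ L be the fields with q and q^t elements. The conjugates P^{σ^k} (k < t)
-- span L^t, hence form a basis. Counting (|K^t| = |L|) shows that every element of L is
-- a K-combination of the coordinates of P, so σ^t is an L-combination of σ^0, …, σ^{t-1}
-- on all of L, and Dedekind's lemma forces σ^t = id. A rational point Q = λ·ι(w) then has
-- coordinates cₖ = σ^k(c₀) ≠ 0 in this basis. For two non-proportional rational points
-- with coordinates c, d every minor cᵢ dⱼ - cⱼ dᵢ (i ≠ j) is nonzero: otherwise c₀/d₀
-- has two equal conjugates, so (t being prime) it is fixed by σ, and then c is a
-- multiple of d. Finally a hyperplane a through t of the t+2 points misses at most two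
-- of them; with fₖ = a·P^{σ^k}, every rational point on it gives Σₖ cₖ fₖ = 0, and a
-- case analysis on whether Q₁, Q₂ lie on it yields a one-term sum cᵢ fᵢ = 0 or a
-- vanishing minor.

open import Defs
open import Level using (0ℓ)
open import Algebra.Bundles using (CommutativeRing)
open import Data.Nat as ℕ using (ℕ; zero; suc; _≤_; _^_)
open import Data.Integer as ℤ using (ℤ; -[1+_]; _⊖_; _◃_)
import Data.Integer.Properties as ℤP
import Data.Nat.Properties as ℕP
open import Data.Sign as Sign using (Sign)
open import Data.Maybe using (Maybe; just; nothing)
open import Data.Fin as Fin using (Fin; zero; suc; punchIn; punchOut; toℕ; finToFun; funToFin; combine)
import Data.Fin.Properties as FinP
open import Data.Product using (∃; _×_; _,_; proj₁; proj₂)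
open import Data.Sum using (_⊎_; inj₁; inj₂)
open import Data.Empty using (⊥; ⊥-elim)
open import Data.Vec.Functional using (insertAt)
open import Data.Vec.Functional.Properties using (insertAt-lookup; insertAt-punchIn)
open import Relation.Nullary using (¬_; Dec; yes; no; ¬?; _×-dec_)
open import Relation.Nullary.Decidable using (decidable-stable)
open import Relation.Binary.PropositionalEquality
open import Relation.Binary.Definitions using (DecidableEquality; tri<; tri≈; tri>)
open import Data.Nat.Coprimality using (Coprime; coprime-Bézout; prime⇒coprime)
open import Data.Nat.Primality using (Prime)
open import Data.Nat.GCD using (module Bézout)
open import Function.Bundles using (_↔_; Inverse)
open import Function.Properties.Inverse using (↔-sym)
open import Function.Base using (case_of_)
open import Function.Definitions using (Injective)
open import Algebra.Solver.Ring.AlmostCommutativeRing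
  using (fromCommutativeRing; _-Raw-AlmostCommutative⟶_)

-- Elementary arithmetic in a field L: the ring normaliser of the standard library
-- with integer coefficients (so that identities involving cancellation hold by
-- computation on the coefficients), and the basic facts about inverses.
module FieldArithmetic (L : Field) where
  commutativeRing : CommutativeRing 0ℓ 0ℓ
  commutativeRing = record { isCommutativeRing = Field.isCommutativeRing L }

  open CommutativeRing commutativeRing public hiding (refl; sym; trans; reflexive; zero)
  open import Algebra.Properties.Ring ring public
  open import Algebra.Properties.Semiring.Mult semiring using (×-homo-+; ×1-homo-*) renaming (_×_ to _×′_)

  fromℤ : ℤ → Carrier
  fromℤ (ℤ.+ n)  = n ×′ 1#
  fromℤ -[1+ n ] = - (suc n ×′ 1#)

  private
    fromℤ-⊖ : ∀ m n → fromℤ (m ⊖ n) ≡ m ×′ 1# - n ×′ 1#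
    fromℤ-⊖ zero    zero    = sym (-‿inverseʳ 0#)
    fromℤ-⊖ zero    (suc n) = sym (+-identityˡ _)
    fromℤ-⊖ (suc m) zero    = sym (trans (cong (suc m ×′ 1# +_) -0#≈0#) (+-identityʳ _))
    fromℤ-⊖ (suc m) (suc n) = begin
      fromℤ (suc m ⊖ suc n)              ≡⟨ cong fromℤ (ℤP.[1+m]⊖[1+n]≡m⊖n m n) ⟩
      fromℤ (m ⊖ n)                      ≡⟨ fromℤ-⊖ m n ⟩
      m ×′ 1# - n ×′ 1#                  ≡⟨ sym (cancel-common 1# (m ×′ 1#) (n ×′ 1#)) ⟩
      (1# + m ×′ 1#) - (1# + n ×′ 1#)    ∎
      where
      open ≡-Reasoning
      cancel-common : ∀ c a b → (c + a) - (c + b) ≡ a - b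
      cancel-common c a b = begin
        (c + a) + - (c + b)     ≡⟨ cong ((c + a) +_) (-‿anti-homo-+ c b) ⟩
        (c + a) + (- b + - c)   ≡⟨ +-assoc c a (- b + - c) ⟩
        c + (a + (- b + - c))   ≡⟨ cong (c +_) (sym (+-assoc a (- b) (- c))) ⟩
        c + ((a - b) + - c)     ≡⟨ cong (c +_) (+-comm (a - b) (- c)) ⟩
        c + (- c + (a - b))     ≡⟨ sym (+-assoc c (- c) (a - b)) ⟩
        (c - c) + (a - b)       ≡⟨ cong (_+ (a - b)) (-‿inverseʳ c) ⟩
        0# + (a - b)            ≡⟨ +-identityˡ _ ⟩
        a - b                   ∎

    case-sign : Sign → Carrier → Carrier
    case-sign Sign.+ x = x
    case-sign Sign.- x = - x

    fromℤ-◃ : ∀ s n → fromℤ (s ◃ n) ≡ (case-sign s) (n ×′ 1#)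
    fromℤ-◃ Sign.+ zero    = refl
    fromℤ-◃ Sign.+ (suc n) = refl
    fromℤ-◃ Sign.- zero    = sym -0#≈0#
    fromℤ-◃ Sign.- (suc n) = refl

  fromℤ-+ : ∀ i j → fromℤ (i ℤ.+ j) ≡ fromℤ i + fromℤ j
  fromℤ-+ (ℤ.+ m)  (ℤ.+ n)  = ×-homo-+ 1# m n
  fromℤ-+ (ℤ.+ m)  -[1+ n ] = fromℤ-⊖ m (suc n)
  fromℤ-+ -[1+ m ] (ℤ.+ n)  = trans (fromℤ-⊖ n (suc m)) (+-comm _ _)
  fromℤ-+ -[1+ m ] -[1+ n ] = begin
    - (suc (suc (m ℕ.+ n)) ×′ 1#)       ≡⟨ cong (λ k → - (suc k ×′ 1#)) (sym (ℕP.+-suc m n)) ⟩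
    - ((suc m ℕ.+ suc n) ×′ 1#)         ≡⟨ cong -_ (×-homo-+ 1# (suc m) (suc n)) ⟩
    - (suc m ×′ 1# + suc n ×′ 1#)       ≡⟨ sym (-‿+-comm _ _) ⟩
    - (suc m ×′ 1#) + - (suc n ×′ 1#)   ∎
    where open ≡-Reasoning

  fromℤ-* : ∀ i j → fromℤ (i ℤ.* j) ≡ fromℤ i * fromℤ j
  fromℤ-* (ℤ.+ m)  (ℤ.+ n)  = trans (fromℤ-◃ Sign.+ (m ℕ.* n)) (×1-homo-* m n)
  fromℤ-* (ℤ.+ m)  -[1+ n ] = trans (fromℤ-◃ Sign.- (m ℕ.* suc n))
    (trans (cong -_ (×1-homo-* m (suc n))) (-‿distribʳ-* _ _))
  fromℤ-* -[1+ m ] (ℤ.+ n)  = trans (fromℤ-◃ Sign.- (suc m ℕ.* n))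
    (trans (cong -_ (×1-homo-* (suc m) n)) (-‿distribˡ-* _ _))
  fromℤ-* -[1+ m ] -[1+ n ] = trans (fromℤ-◃ Sign.+ (suc m ℕ.* suc n))
    (trans (×1-homo-* (suc m) (suc n)) (minus-times-minus _ _))
    where
    minus-times-minus : ∀ x y → x * y ≡ - x * - y
    minus-times-minus x y = trans (cong (_* y) (sym (-‿involutive x)))
      (trans (sym (-‿distribˡ-* (- x) y)) (-‿distribʳ-* (- x) y))

  fromℤ-neg : ∀ i → fromℤ (ℤ.- i) ≡ - fromℤ i
  fromℤ-neg (ℤ.+ zero)  = sym -0#≈0#
  fromℤ-neg (ℤ.+ suc n) = refl
  fromℤ-neg -[1+ n ]    = sym (-‿involutive _)

  private
    ℤ-coefficients : CommutativeRing.rawRing ℤP.+-*-commutativeRing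
      -Raw-AlmostCommutative⟶ fromCommutativeRing commutativeRing
    ℤ-coefficients = record
      { ⟦_⟧ = fromℤ ; +-homo = fromℤ-+ ; *-homo = fromℤ-* ; -‿homo = fromℤ-neg
      ; 0-homo = refl ; 1-homo = +-identityʳ 1# }

    coefficient-equal? : ∀ i j → Maybe (fromℤ i ≡ fromℤ j)
    coefficient-equal? i j with i ℤ.≟ j
    ... | yes i≡j = just (cong fromℤ i≡j)
    ... | no _    = nothing

  open import Algebra.Solver.Ring _ _ ℤ-coefficients coefficient-equal? public
    using (solve; _:=_; _:+_; _:*_; :-_; _:-_; con)

  1≢0 : 1# ≢ 0#
  1≢0 e = Field.0≢1 L (sym e)

  -1≢0 : - 1# ≢ 0#
  -1≢0 e = 1≢0 (trans (sym (-‿involutive 1#)) (trans (cong -_ e) -0#≈0#))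

  neg-unique : ∀ x y → x + y ≡ 0# → y ≡ - x
  neg-unique x y e = trans (solve 2 (λ x y → y := (:- x) :+ (x :+ y)) refl x y)
                           (trans (cong (- x +_) e) (+-identityʳ _))

  difference-zero : ∀ {x y} → x - y ≡ 0# → x ≡ y
  difference-zero {x} {y} e = trans (solve 2 (λ x y → x := (x :- y) :+ y) refl x y)
                                    (trans (cong (_+ y) e) (+-identityˡ y))

  inv : ∀ x → x ≢ 0# → Carrier
  inv x x≢0 = proj₁ (Field.inverse L x x≢0)

  inv-l : ∀ x (x≢0 : x ≢ 0#) → inv x x≢0 * x ≡ 1#
  inv-l x x≢0 = trans (*-comm _ _) (proj₂ (Field.inverse L x x≢0))

  inv≢0 : ∀ x (x≢0 : x ≢ 0#) → inv x x≢0 ≢ 0#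
  inv≢0 x x≢0 e = 1≢0 (trans (sym (inv-l x x≢0)) (trans (cong (_* x) e) (zeroˡ x)))

  *-cancelˡ : ∀ {a b c} → a ≢ 0# → a * b ≡ a * c → b ≡ c
  *-cancelˡ {a} {b} {c} a≢0 e = begin
    b                     ≡⟨ sym (*-identityˡ b) ⟩
    1# * b                ≡⟨ cong (_* b) (sym (inv-l a a≢0)) ⟩
    (inv a a≢0 * a) * b   ≡⟨ *-assoc _ _ _ ⟩
    inv a a≢0 * (a * b)   ≡⟨ cong (inv a a≢0 *_) e ⟩
    inv a a≢0 * (a * c)   ≡⟨ sym (*-assoc _ _ _) ⟩
    (inv a a≢0 * a) * c   ≡⟨ cong (_* c) (inv-l a a≢0) ⟩
    1# * c                ≡⟨ *-identityˡ c ⟩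
    c                     ∎
    where open ≡-Reasoning

  no-zero-divisor : ∀ {a b} → a ≢ 0# → a * b ≡ 0# → b ≡ 0#
  no-zero-divisor {a} a≢0 e = *-cancelˡ a≢0 (trans e (sym (zeroʳ a)))

  *-≢0 : ∀ {a b} → a ≢ 0# → b ≢ 0# → a * b ≢ 0#
  *-≢0 a≢0 b≢0 e = b≢0 (no-zero-divisor a≢0 e)

module FiniteSums (L : Field) where
  open FieldArithmetic L

  Σ : ∀ {n} → (Fin n → Carrier) → Carrier
  Σ f = Σ[_] L f

  Σ-cong : ∀ {n} {f g : Fin n → Carrier} → (∀ i → f i ≡ g i) → Σ f ≡ Σ g
  Σ-cong {zero}  h = refl
  Σ-cong {suc n} h = cong₂ _+_ (h zero) (Σ-cong (λ i → h (suc i)))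

  Σ-zero : ∀ {n} {f : Fin n → Carrier} → (∀ i → f i ≡ 0#) → Σ f ≡ 0#
  Σ-zero {zero}  h = refl
  Σ-zero {suc n} h = trans (cong₂ _+_ (h zero) (Σ-zero (λ i → h (suc i)))) (+-identityˡ 0#)

  Σ-+ : ∀ {n} (f g : Fin n → Carrier) → Σ (λ i → f i + g i) ≡ Σ f + Σ g
  Σ-+ {zero}  f g = sym (+-identityˡ 0#)
  Σ-+ {suc n} f g = trans (cong ((f zero + g zero) +_) (Σ-+ (λ i → f (suc i)) (λ i → g (suc i))))
    (solve 4 (λ a b c d → (a :+ b) :+ (c :+ d) := (a :+ c) :+ (b :+ d)) refl _ _ _ _)

  Σ-*ˡ : ∀ {n} (c : Carrier) (f : Fin n → Carrier) → Σ (λ i → c * f i) ≡ c * Σ f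
  Σ-*ˡ {zero}  c f = sym (zeroʳ c)
  Σ-*ˡ {suc n} c f = trans (cong (c * f zero +_) (Σ-*ˡ c (λ i → f (suc i)))) (sym (distribˡ c _ _))

  Σ-*ʳ : ∀ {n} (c : Carrier) (f : Fin n → Carrier) → Σ (λ i → f i * c) ≡ Σ f * c
  Σ-*ʳ c f = trans (Σ-cong (λ i → *-comm (f i) c)) (trans (Σ-*ˡ c f) (*-comm c _))

  Σ-neg : ∀ {n} (f : Fin n → Carrier) → Σ (λ i → - f i) ≡ - Σ f
  Σ-neg f = trans (Σ-cong (λ i → sym (-1*x≈-x (f i)))) (trans (Σ-*ˡ (- 1#) f) (-1*x≈-x _))

  Σ-sub : ∀ {n} (f g : Fin n → Carrier) → Σ (λ i → f i - g i) ≡ Σ f - Σ g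
  Σ-sub f g = trans (Σ-+ f (λ i → - g i)) (cong (Σ f +_) (Σ-neg g))

  Σ-*-difference : ∀ {n} (a b v : Fin n → Carrier) →
                   Σ (λ i → (a i - b i) * v i) ≡ Σ (λ i → a i * v i) - Σ (λ i → b i * v i)
  Σ-*-difference a b v =
    trans (Σ-cong (λ i → solve 3 (λ A B V → (A :- B) :* V := A :* V :- B :* V) refl (a i) (b i) (v i)))
          (Σ-sub (λ i → a i * v i) (λ i → b i * v i))

  Σ-swap : ∀ {m n} (f : Fin m → Fin n → Carrier) → Σ (λ i → Σ (λ j → f i j)) ≡ Σ (λ j → Σ (λ i → f i j))
  Σ-swap {zero}  {n} f = sym (Σ-zero {n} (λ _ → refl))
  Σ-swap {suc m} {n} f = trans (cong (Σ (f zero) +_) (Σ-swap (λ i → f (suc i))))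
    (sym (Σ-+ (λ j → f zero j) (λ j → Σ (λ i → f (suc i) j))))

  Σ-matrix-assoc : ∀ {m n} (x : Fin m → Carrier) (M : Fin m → Fin n → Carrier) (y : Fin n → Carrier) →
                   Σ (λ i → x i * Σ (λ j → M i j * y j)) ≡ Σ (λ j → Σ (λ i → x i * M i j) * y j)
  Σ-matrix-assoc x M y = begin
    Σ (λ i → x i * Σ (λ j → M i j * y j))   ≡⟨ Σ-cong (λ i → sym (Σ-*ˡ (x i) (λ j → M i j * y j))) ⟩
    Σ (λ i → Σ (λ j → x i * (M i j * y j))) ≡⟨ Σ-swap (λ i j → x i * (M i j * y j)) ⟩
    Σ (λ j → Σ (λ i → x i * (M i j * y j))) ≡⟨ Σ-cong (λ j → Σ-cong (λ i → sym (*-assoc (x i) (M i j) (y j)))) ⟩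
    Σ (λ j → Σ (λ i → x i * M i j * y j))   ≡⟨ Σ-cong (λ j → Σ-*ʳ (y j) (λ i → x i * M i j)) ⟩
    Σ (λ j → Σ (λ i → x i * M i j) * y j)   ∎
    where open ≡-Reasoning

  Σ-punch : ∀ {n} (f : Fin (suc n) → Carrier) (i : Fin (suc n)) → Σ f ≡ f i + Σ (λ j → f (punchIn i j))
  Σ-punch f zero = refl
  Σ-punch {suc n} f (suc i) = trans (cong (f zero +_) (Σ-punch (λ j → f (suc j)) i))
    (solve 3 (λ a b c → a :+ (b :+ c) := b :+ (a :+ c)) refl _ _ _)

  Σ-last : ∀ {n} (f : Fin (suc n) → Carrier) → Σ f ≡ Σ (λ j → f (Fin.inject₁ j)) + f (Fin.fromℕ n)
  Σ-last {zero}  f = +-comm (f zero) 0#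
  Σ-last {suc n} f = trans (cong (f zero +_) (Σ-last (λ i → f (suc i)))) (sym (+-assoc _ _ _))

  Σ-single : ∀ {n} (f : Fin n → Carrier) (x : Fin n) → (∀ i → i ≢ x → f i ≡ 0#) → Σ f ≡ f x
  Σ-single {suc n} f x h = trans (Σ-punch f x)
    (trans (cong (f x +_) (Σ-zero (λ j → h _ (FinP.punchInᵢ≢i x j)))) (+-identityʳ _))

  Σ-pair : ∀ {n} (f : Fin n → Carrier) x y → x ≢ y → (∀ i → i ≢ x → i ≢ y → f i ≡ 0#) → Σ f ≡ f x + f y
  Σ-pair {suc n} f x y x≢y h = trans (Σ-punch f x) (cong (f x +_)
    (trans (Σ-single (λ k → f (punchIn x k)) (punchOut x≢y) off-y) (cong f (FinP.punchIn-punchOut x≢y))))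
    where
    off-y : ∀ k → k ≢ punchOut x≢y → f (punchIn x k) ≡ 0#
    off-y k k≢y = h (punchIn x k) (FinP.punchInᵢ≢i x k)
      (λ e → k≢y (FinP.punchIn-injective x k _ (trans e (sym (FinP.punchIn-punchOut x≢y)))))

  single-term≢0 : ∀ {n} (c f : Fin n → Carrier) i → (∀ k → k ≢ i → f k ≡ 0#) →
                  c i ≢ 0# → f i ≢ 0# → Σ (λ k → c k * f k) ≢ 0#
  single-term≢0 c f i off-i ci≢0 fi≢0 sum≡0 =
    *-≢0 ci≢0 fi≢0 (trans (sym (Σ-single _ i (λ k k≢i → trans (cong (c k *_) (off-i k k≢i)) (zeroʳ _)))) sum≡0)

  two-term-minor : ∀ {n} (c d f : Fin n → Carrier) i j → i ≢ j → (∀ k → k ≢ i → k ≢ j → f k ≡ 0#) →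
                   f i ≢ 0# → Σ (λ k → c k * f k) ≡ 0# → Σ (λ k → d k * f k) ≡ 0# → c i * d j ≡ c j * d i
  two-term-minor c d f i j i≢j off fi≢0 c-relation d-relation = *-cancelˡ fi≢0 (begin
    f i * (c i * d j)      ≡⟨ solve 3 (λ F C D → F :* (C :* D) := (C :* F) :* D) refl (f i) (c i) (d j) ⟩
    (c i * f i) * d j      ≡⟨ cong (_* d j) (two-terms c c-relation) ⟩
    - (c j * f j) * d j    ≡⟨ solve 3 (λ C F D → :- (C :* F) :* D := C :* :- (D :* F)) refl (c j) (f j) (d j) ⟩
    c j * - (d j * f j)    ≡⟨ cong (c j *_) (sym (two-terms d d-relation)) ⟩
    c j * (d i * f i)      ≡⟨ solve 3 (λ C D F → C :* (D :* F) := F :* (C :* D)) refl (c j) (d i) (f i) ⟩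
    f i * (c j * d i)      ∎)
    where
    open ≡-Reasoning
    two-terms : ∀ e → Σ (λ k → e k * f k) ≡ 0# → e i * f i ≡ - (e j * f j)
    two-terms e relation = neg-unique _ _ (trans (+-comm _ _)
      (trans (sym (Σ-pair (λ k → e k * f k) i j i≢j (λ k k≢i k≢j → trans (cong (e k *_) (off k k≢i k≢j)) (zeroʳ _))))
             relation))

  δ : ∀ {n} → Fin n → Fin n → Carrier
  δ i j with i FinP.≟ j
  ... | yes _ = 1#
  ... | no _  = 0#

  δ-refl : ∀ {n} (i : Fin n) → δ i i ≡ 1#
  δ-refl i with i FinP.≟ i
  ... | yes _  = refl
  ... | no i≢i = ⊥-elim (i≢i refl)

  δ-≢ : ∀ {n} {i j : Fin n} → i ≢ j → δ i j ≡ 0#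
  δ-≢ {i = i} {j} i≢j with i FinP.≟ j
  ... | yes i≡j = ⊥-elim (i≢j i≡j)
  ... | no _    = refl

  Σ-δˡ : ∀ {n} (x : Fin n) (f : Fin n → Carrier) → Σ (λ i → δ x i * f i) ≡ f x
  Σ-δˡ x f = trans (Σ-single _ x (λ i i≢x → trans (cong (_* f i) (δ-≢ (λ e → i≢x (sym e)))) (zeroˡ _)))
                   (trans (cong (_* f x) (δ-refl x)) (*-identityˡ _))

  Σ-δʳ : ∀ {n} (x : Fin n) (f : Fin n → Carrier) → Σ (λ i → f i * δ i x) ≡ f x
  Σ-δʳ x f = trans (Σ-single _ x (λ i i≢x → trans (cong (f i *_) (δ-≢ i≢x)) (zeroʳ _)))
                   (trans (cong (f x *_) (δ-refl x)) (*-identityʳ _))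

module LinearAlgebra (L : Field) (_≟_ : DecidableEquality (Field.Carrier L)) where
  open FieldArithmetic L
  open FiniteSums L

  combination : ∀ {k n} → (Fin k → Carrier) → (Fin k → Vec L n) → Vec L n
  combination a v r = Σ (λ i → a i * v i r)

  LinearlyIndependent : ∀ {k n} → (Fin k → Vec L n) → Set
  LinearlyIndependent v = ∀ a → (∀ r → combination a v r ≡ 0#) → ∀ i → a i ≡ 0#

  Spanning : ∀ {k n} → (Fin k → Vec L n) → Set
  Spanning v = ∀ w → InSpan L v w

  zero-or-nonzero-entry : ∀ {n} (f : Fin n → Carrier) → (∀ i → f i ≡ 0#) ⊎ (∃ λ i → f i ≢ 0#)
  zero-or-nonzero-entry {n} f with FinP.all? (λ i → f i ≟ 0#)
  ... | yes all-zero = inj₁ all-zero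
  ... | no not-all   = inj₂ (FinP.¬∀⟶∃¬ n _ (λ i → f i ≟ 0#) not-all)

  NontrivialRelation : ∀ {k n} → (Fin k → Vec L n) → Set
  NontrivialRelation v = ∃ λ a → (∃ λ i → a i ≢ 0#) × (∀ r → combination a v r ≡ 0#)

  -- m+1 vectors in L^m are linearly dependent (Gaussian elimination on the first
  -- coordinate, by induction on m).
  dependent : ∀ m (v : Fin (suc m) → Vec L m) → NontrivialRelation v
  dependent zero v = (λ _ → 1#) , (zero , 1≢0) , (λ ())
  dependent (suc m) v with zero-or-nonzero-entry (λ i → v i zero)
  ... | inj₁ column-zero = first-column-zero column-zero (dependent m (λ j r → v (suc j) (suc r)))
    where
    -- the vectors v 1, …, v (m+1) have zero first coordinate, so a relation among
    -- their tails is a relation among them.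
    first-column-zero : (∀ i → v i zero ≡ 0#) → NontrivialRelation (λ j r → v (suc j) (suc r)) → NontrivialRelation v
    first-column-zero z (a , (j , aj≢0) , rel) = insertAt a zero 0# , (suc j , aj≢0) , rel′
      where
      rel′ : ∀ r → combination (insertAt a zero 0#) v r ≡ 0#
      rel′ zero    = trans (cong₂ _+_ (zeroˡ _) (Σ-zero (λ j → trans (cong (a j *_) (z (suc j))) (zeroʳ _))))
                           (+-identityˡ 0#)
      rel′ (suc r) = trans (cong₂ _+_ (zeroˡ _) (rel r)) (+-identityˡ 0#)
  ... | inj₂ (p , pivot≢0) = pivot-step (dependent m reduced)
    where
    -- clearing the first coordinate of the other vectors with the pivot vector v p
    ratio : Fin (suc m) → Carrier
    ratio j = v (punchIn p j) zero * inv _ pivot≢0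
    reduced : Fin (suc m) → Vec L m
    reduced j r = v (punchIn p j) (suc r) - ratio j * v p (suc r)

    pivot-step : NontrivialRelation reduced → NontrivialRelation v
    pivot-step (a , (j , aj≢0) , rel) = b , (punchIn p j , subst (_≢ 0#) (sym (insertAt-punchIn a p _ j)) aj≢0) , rel′
      where
      β : Carrier
      β = Σ (λ j → a j * ratio j)
      b : Fin (suc (suc m)) → Carrier
      b = insertAt a p (- β)

      others : ∀ r → Σ (λ j → a j * v (punchIn p j) r) ≡ β * v p r
      others zero = trans (Σ-cong (λ j → trans (cong (a j *_) (first-entry j)) (sym (*-assoc _ _ _))))
                          (Σ-*ʳ (v p zero) (λ j → a j * ratio j))
        where
        first-entry : ∀ j → v (punchIn p j) zero ≡ ratio j * v p zero
        first-entry j = sym (trans (*-assoc _ _ _) (trans (cong (v (punchIn p j) zero *_) (inv-l _ pivot≢0))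
                                                          (*-identityʳ _)))
      others (suc r) = begin
        Σ (λ j → a j * v (punchIn p j) (suc r))
          ≡⟨ Σ-cong (λ j → solve 4 (λ A W C X → A :* W := A :* (W :- C :* X) :+ (A :* C) :* X)
                                   refl (a j) (v (punchIn p j) (suc r)) (ratio j) (v p (suc r))) ⟩
        Σ (λ j → a j * reduced j r + (a j * ratio j) * v p (suc r))
          ≡⟨ Σ-+ (λ j → a j * reduced j r) (λ j → (a j * ratio j) * v p (suc r)) ⟩
        combination a reduced r + Σ (λ j → (a j * ratio j) * v p (suc r))
          ≡⟨ cong₂ _+_ (rel r) (Σ-*ʳ (v p (suc r)) (λ j → a j * ratio j)) ⟩
        0# + β * v p (suc r)
          ≡⟨ +-identityˡ _ ⟩
        β * v p (suc r) ∎
        where open ≡-Reasoning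

      rel′ : ∀ r → combination b v r ≡ 0#
      rel′ r = begin
        combination b v r
          ≡⟨ Σ-punch (λ i → b i * v i r) p ⟩
        b p * v p r + Σ (λ j → b (punchIn p j) * v (punchIn p j) r)
          ≡⟨ cong₂ _+_ (cong (_* v p r) (insertAt-lookup a p (- β)))
                       (Σ-cong (λ j → cong (_* v (punchIn p j) r) (insertAt-punchIn a p (- β) j))) ⟩
        - β * v p r + Σ (λ j → a j * v (punchIn p j) r)
          ≡⟨ cong (- β * v p r +_) (others r) ⟩
        - β * v p r + β * v p r
          ≡⟨ solve 2 (λ B X → (:- B) :* X :+ B :* X := con (ℤ.+ 0)) refl β (v p r) ⟩
        0# ∎
        where open ≡-Reasoning

  module SpanningCoordinates {k n} (u : Fin k → Vec L n) (spanning : Spanning u) where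
    C : Fin n → Fin k → Carrier
    C i = proj₁ (spanning (δ i))

    C-spec : ∀ i r → δ i r ≡ combination (C i) u r
    C-spec i = proj₂ (spanning (δ i))

    annihilator-zero : ∀ a → (∀ j → Σ (λ r → a r * u j r) ≡ 0#) → ∀ i → a i ≡ 0#
    annihilator-zero a vanishes i = begin
      a i                                      ≡⟨ sym (Σ-δˡ i a) ⟩
      Σ (λ r → δ i r * a r)                    ≡⟨ Σ-cong (λ r → cong (_* a r) (C-spec i r)) ⟩
      Σ (λ r → combination (C i) u r * a r)    ≡⟨ sym (Σ-matrix-assoc (C i) u a) ⟩
      Σ (λ j → C i j * Σ (λ r → u j r * a r))  ≡⟨ Σ-zero (λ j → trans (cong (C i j *_) (vanishes′ j)) (zeroʳ _)) ⟩
      0#                                       ∎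
      where
      open ≡-Reasoning
      vanishes′ : ∀ j → Σ (λ r → u j r * a r) ≡ 0#
      vanishes′ j = trans (Σ-cong (λ r → *-comm (u j r) (a r))) (vanishes j)

    recombine : ∀ (x : Fin n → Carrier) r → combination (λ j → Σ (λ i → x i * C i j)) u r ≡ x r
    recombine x r = begin
      Σ (λ j → Σ (λ i → x i * C i j) * u j r)   ≡⟨ sym (Σ-matrix-assoc x C (λ j → u j r)) ⟩
      Σ (λ i → x i * combination (C i) u r)     ≡⟨ Σ-cong (λ i → cong (x i *_) (sym (C-spec i r))) ⟩
      Σ (λ i → x i * δ i r)                     ≡⟨ Σ-δʳ r x ⟩
      x r                                       ∎
      where open ≡-Reasoning

  -- n vectors spanning L^n are linearly independent: a relation Σ d_k u_k = 0 and
  -- the n rows C i form n+1 vectors of L^n, whose dependence forces d = 0.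
  spanning⇒independent : ∀ {n} (u : Fin n → Vec L n) → Spanning u → LinearlyIndependent u
  spanning⇒independent {n} u spanning d relation = d-zero
    where
    open SpanningCoordinates u spanning
    V : Fin (suc n) → Vec L n
    V zero    = d
    V (suc i) = C i
    D : NontrivialRelation V
    D = dependent n V
    a : Fin (suc n) → Carrier
    a = proj₁ D
    a-relation : ∀ j → a zero * d j + Σ (λ i → a (suc i) * C i j) ≡ 0#
    a-relation = proj₂ (proj₂ D)

    a-tail-zero : ∀ r → a (suc r) ≡ 0#
    a-tail-zero r = begin
      a (suc r)                                        ≡⟨ sym (recombine (λ i → a (suc i)) r) ⟩
      Σ (λ j → Σ (λ i → a (suc i) * C i j) * u j r)    ≡⟨ Σ-cong (λ j → cong (_* u j r) (neg-unique _ _ (a-relation j))) ⟩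
      Σ (λ j → - (a zero * d j) * u j r)               ≡⟨ Σ-cong (λ j → solve 3 (λ A D U → (:- (A :* D)) :* U := :- A :* (D :* U)) refl (a zero) (d j) (u j r)) ⟩
      Σ (λ j → - a zero * (d j * u j r))               ≡⟨ Σ-*ˡ (- a zero) (λ j → d j * u j r) ⟩
      - a zero * combination d u r                     ≡⟨ cong (- a zero *_) (relation r) ⟩
      - a zero * 0#                                    ≡⟨ zeroʳ _ ⟩
      0#                                               ∎
      where open ≡-Reasoning

    a-head≢0 : a zero ≢ 0#
    a-head≢0 with proj₁ (proj₂ D)
    ... | zero  , a₀≢0 = a₀≢0
    ... | suc r , ar≢0 = ⊥-elim (ar≢0 (a-tail-zero r))

    d-zero : ∀ k → d k ≡ 0#
    d-zero k = no-zero-divisor a-head≢0 (trans (sym (+-identityʳ _)) (trans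
      (cong (a zero * d k +_) (sym (Σ-zero (λ i → trans (cong (_* C i k) (a-tail-zero i)) (zeroˡ _)))))
      (a-relation k)))

  independent⇒injective : ∀ {k n} (u : Fin k → Vec L n) → LinearlyIndependent u →
                          ∀ {i j} → (∀ r → u i r ≡ u j r) → i ≡ j
  independent⇒injective u independent {i} {j} ui≡uj with i FinP.≟ j
  ... | yes i≡j = i≡j
  ... | no i≢j  = ⊥-elim (1≢0 (trans (sym δ-difference) (independent (λ k → δ i k - δ j k) relation i)))
    where
    δ-difference : δ i i - δ j i ≡ 1#
    δ-difference = trans (cong₂ _-_ (δ-refl i) (δ-≢ (λ e → i≢j (sym e))))
                         (trans (cong (1# +_) -0#≈0#) (+-identityʳ 1#))
    relation : ∀ r → combination (λ k → δ i k - δ j k) u r ≡ 0#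
    relation r = trans (Σ-*-difference (δ i) (δ j) (λ k → u k r))
      (trans (cong₂ _-_ (Σ-δˡ i (λ k → u k r)) (Σ-δˡ j (λ k → u k r)))
             (trans (cong (_- u j r) (ui≡uj r)) (-‿inverseʳ _)))

module Dedekind (L : Field) where
  open FieldArithmetic L
  open FiniteSums L

  Multiplicative : (Carrier → Carrier) → Set
  Multiplicative χ = (∀ x y → χ (x * y) ≡ χ x * χ y) × χ 1# ≡ 1#

  dedekind : ∀ n (χ : Fin n → Carrier → Carrier) → (∀ j → Multiplicative (χ j)) →
             (∀ i j → i ≢ j → ∃ λ y → χ i y ≢ χ j y) →
             ∀ (b : Fin n → Carrier) → (∀ x → Σ (λ j → b j * χ j x) ≡ 0#) → ∀ j → b j ≡ 0#
  dedekind (suc n) χ multiplicative distinct b relation = b-zero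
    where
    χ′ : Fin n → Carrier → Carrier
    χ′ j = χ (suc j)

    rest : Carrier → Carrier
    rest x = Σ (λ j → b (suc j) * χ′ j x)

    rest-spec : ∀ x → rest x ≡ - (b zero * χ zero x)
    rest-spec x = neg-unique _ _ (relation x)

    -- Comparing the relation at y * x with χ₀(y) times the relation at x gives a
    -- relation among χ₁, …, χₙ with coefficients b_{j+1} (χ_{j+1}(y) - χ₀(y)).
    shifted : Carrier → Fin n → Carrier
    shifted y j = b (suc j) * (χ′ j y - χ zero y)

    shifted-relation : ∀ y x → Σ (λ j → shifted y j * χ′ j x) ≡ 0#
    shifted-relation y x = begin
      Σ (λ j → shifted y j * χ′ j x)
        ≡⟨ Σ-cong (λ j → trans (expand j) (cong (λ z → b (suc j) * z - χ zero y * (b (suc j) * χ′ j x))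
                                                  (sym (proj₁ (multiplicative (suc j)) y x)))) ⟩
      Σ (λ j → b (suc j) * χ′ j (y * x) - χ zero y * (b (suc j) * χ′ j x))
        ≡⟨ Σ-sub (λ j → b (suc j) * χ′ j (y * x)) (λ j → χ zero y * (b (suc j) * χ′ j x)) ⟩
      rest (y * x) - Σ (λ j → χ zero y * (b (suc j) * χ′ j x))
        ≡⟨ cong (λ z → rest (y * x) - z) (Σ-*ˡ (χ zero y) (λ j → b (suc j) * χ′ j x)) ⟩
      rest (y * x) - χ zero y * rest x
        ≡⟨ cong₂ (λ p q → p - χ zero y * q)
             (trans (rest-spec (y * x)) (cong (λ z → - (b zero * z)) (proj₁ (multiplicative zero) y x)))
             (rest-spec x) ⟩
      - (b zero * (χ zero y * χ zero x)) - χ zero y * - (b zero * χ zero x)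
        ≡⟨ solve 3 (λ B Y X → :- (B :* (Y :* X)) :- Y :* :- (B :* X) := con (ℤ.+ 0)) refl
                   (b zero) (χ zero y) (χ zero x) ⟩
      0# ∎
      where
      open ≡-Reasoning
      expand : ∀ j → shifted y j * χ′ j x ≡ b (suc j) * (χ′ j y * χ′ j x) - χ zero y * (b (suc j) * χ′ j x)
      expand j = solve 4 (λ B A C X → B :* (A :- C) :* X := B :* (A :* X) :- C :* (B :* X))
                         refl (b (suc j)) (χ′ j y) (χ zero y) (χ′ j x)

    b-tail-zero : ∀ j → b (suc j) ≡ 0#
    b-tail-zero j with distinct (suc j) zero (λ ())
    ... | y , χy≢ = no-zero-divisor difference≢0 (trans (*-comm _ _) shifted-zero)
      where
      shifted-zero : shifted y j ≡ 0#
      shifted-zero = dedekind n χ′ (λ j → multiplicative (suc j))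
        (λ i k i≢k → distinct (suc i) (suc k) (λ e → i≢k (FinP.suc-injective e)))
        (shifted y) (shifted-relation y) j
      difference≢0 : χ′ j y - χ zero y ≢ 0#
      difference≢0 e = χy≢ (difference-zero e)

    b-zero : ∀ j → b j ≡ 0#
    b-zero (suc j) = b-tail-zero j
    b-zero zero = begin
      b zero                        ≡⟨ sym (*-identityʳ _) ⟩
      b zero * 1#                   ≡⟨ cong (b zero *_) (sym (proj₂ (multiplicative zero))) ⟩
      b zero * χ zero 1#            ≡⟨ sym (+-identityʳ _) ⟩
      b zero * χ zero 1# + 0#       ≡⟨ cong (b zero * χ zero 1# +_)
                                         (sym (Σ-zero (λ j → trans (cong (_* χ′ j 1#) (b-tail-zero j)) (zeroˡ _)))) ⟩
      Σ (λ j → b j * χ j 1#)        ≡⟨ relation 1# ⟩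
      0#                            ∎
      where open ≡-Reasoning

↔-injective : ∀ {A B : Set} (A↔B : A ↔ B) {x y} → Inverse.to A↔B x ≡ Inverse.to A↔B y → x ≡ y
↔-injective A↔B {x} {y} e = trans (sym (Inverse.strictlyInverseʳ A↔B x))
                                  (trans (cong (Inverse.from A↔B) e) (Inverse.strictlyInverseʳ A↔B y))

decidable-from-size : ∀ {A : Set} {N : ℕ} → A ↔ Fin N → DecidableEquality A
decidable-from-size A↔Fin x y with Inverse.to A↔Fin x FinP.≟ Inverse.to A↔Fin y
... | yes e = yes (↔-injective A↔Fin e)
... | no ne = no (λ e → ne (cong (Inverse.to A↔Fin) e))

module _ {A B : Set} {N : ℕ} (A↔Fin : A ↔ Fin N) (_≟_ : DecidableEquality B) (f g : A → B) where
  private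
    from = Inverse.from A↔Fin
    agree-at? : ∀ z → Dec (f (from z) ≡ g (from z))
    agree-at? z = f (from z) ≟ g (from z)
    everywhere : (∀ z → f (from z) ≡ g (from z)) → ∀ x → f x ≡ g x
    everywhere agree x = subst (λ y → f y ≡ g y) (Inverse.strictlyInverseʳ A↔Fin x) (agree (Inverse.to A↔Fin x))

  pointwise-equal? : Dec (∀ x → f x ≡ g x)
  pointwise-equal? with FinP.all? agree-at?
  ... | yes agree = yes (everywhere agree)
  ... | no ¬agree = no (λ agree → ¬agree (λ z → agree (from z)))

  differ-somewhere : ¬ (∀ x → f x ≡ g x) → ∃ λ x → f x ≢ g x
  differ-somewhere ¬agree with FinP.¬∀⟶∃¬ N _ agree-at? (λ agree → ¬agree (everywhere agree))
  ... | z , differ = from z , differ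

squeeze : ∀ {n m} (s : Fin n → Fin (suc m)) (x : Fin (suc m)) → (∀ j → s j ≢ x) → Fin n → Fin m
squeeze s x misses j = punchOut {i = x} {j = s j} (λ e → misses j (sym e))

squeeze-injective : ∀ {n m} (s : Fin n → Fin (suc m)) → Injective _≡_ _≡_ s →
                    ∀ x (misses : ∀ j → s j ≢ x) → Injective _≡_ _≡_ (squeeze s x misses)
squeeze-injective s s-injective x misses {j} {k} e =
  s-injective (FinP.punchOut-injective (λ e′ → misses j (sym e′)) (λ e′ → misses k (sym e′)) e)

squeeze-misses : ∀ {n m} (s : Fin n → Fin (suc m)) x (misses : ∀ j → s j ≢ x) →
                 ∀ y (x≢y : x ≢ y) → (∀ j → s j ≢ y) → ∀ j → squeeze s x misses j ≢ punchOut x≢y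
squeeze-misses s x misses y x≢y misses-y j e = misses-y j (FinP.punchOut-injective (λ e′ → misses j (sym e′)) x≢y e)

injective⇒surjective : ∀ {n} (f : Fin n → Fin n) → Injective _≡_ _≡_ f → ∀ y → ∃ λ x → f x ≡ y
injective⇒surjective {suc n} f f-injective y with FinP.any? (λ x → f x FinP.≟ y)
... | yes hit = hit
... | no miss = ⊥-elim (ℕP.1+n≰n (FinP.injective⇒≤ (squeeze-injective f f-injective y y-missed)))
  where
  y-missed : ∀ x → f x ≢ y
  y-missed x e = miss (x , e)

onto-by-counting : ∀ {B : Set} {N : ℕ} → B ↔ Fin N → (g : Fin N → B) → Injective _≡_ _≡_ g →
                   ∀ y → ∃ λ z → g z ≡ y
onto-by-counting B↔Fin g g-injective y
  with injective⇒surjective (λ z → Inverse.to B↔Fin (g z))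
         (λ e → g-injective (↔-injective B↔Fin e)) (Inverse.to B↔Fin y)
... | z , hit = z , ↔-injective B↔Fin hit

finToFun-injective : ∀ {m n} (z z′ : Fin (m ^ n)) → (∀ i → finToFun {m} {n} z i ≡ finToFun {m} {n} z′ i) → z ≡ z′
finToFun-injective {m} {n} z z′ same-digits = trans (sym (FinP.funToFin-finToFin {n} {m} z))
  (trans (funToFin-cong same-digits) (FinP.funToFin-finToFin {n} {m} z′))
  where
  funToFin-cong : ∀ {k} {f g : Fin k → Fin m} → (∀ i → f i ≡ g i) → funToFin f ≡ funToFin g
  funToFin-cong {zero}  h = refl
  funToFin-cong {suc k} h = cong₂ combine (h zero) (funToFin-cong (λ i → h (suc i)))

misses-at-most-two : ∀ {n} (s : Fin n → Fin (suc (suc n))) → Injective _≡_ _≡_ s →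
                     ∀ x y z → x ≢ y → x ≢ z → y ≢ z →
                     (∀ j → s j ≢ x) → (∀ j → s j ≢ y) → (∀ j → s j ≢ z) → ⊥
misses-at-most-two {n} s s-injective x y z x≢y x≢z y≢z misses-x misses-y misses-z =
  squeeze-misses s₁ y₁ misses-y₁ z₁ y₁≢z₁ misses-z₁ (proj₁ z₂-hit) (proj₂ z₂-hit)
  where
  -- removing x, the injection s₁ misses the images y₁, z₁ of y, z
  s₁ : Fin n → Fin (suc n)
  s₁ = squeeze s x misses-x
  y₁ z₁ : Fin (suc n)
  y₁ = punchOut x≢y
  z₁ = punchOut x≢z
  misses-y₁ : ∀ j → s₁ j ≢ y₁
  misses-y₁ = squeeze-misses s x misses-x y x≢y misses-y
  misses-z₁ : ∀ j → s₁ j ≢ z₁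
  misses-z₁ = squeeze-misses s x misses-x z x≢z misses-z
  y₁≢z₁ : y₁ ≢ z₁
  y₁≢z₁ e = y≢z (FinP.punchOut-injective x≢y x≢z e)
  -- removing y₁ as well leaves an injection Fin n → Fin n, which must hit z
  s₂ : Fin n → Fin n
  s₂ = squeeze s₁ y₁ misses-y₁
  z₂-hit : ∃ λ j → s₂ j ≡ punchOut y₁≢z₁
  z₂-hit = injective⇒surjective s₂ (squeeze-injective s₁ (squeeze-injective s s-injective x misses-x) y₁ misses-y₁)
                                (punchOut y₁≢z₁)

iter-+ : ∀ {A : Set} (m n : ℕ) (f : A → A) x → iter (m ℕ.+ n) f x ≡ iter m f (iter n f x)
iter-+ zero    n f x = refl
iter-+ (suc m) n f x = cong f (iter-+ m n f x)

iter-*-fixed : ∀ {A : Set} (m : ℕ) (f : A → A) {y} → iter m f y ≡ y → ∀ k → iter (k ℕ.* m) f y ≡ y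
iter-*-fixed m f fixed zero    = refl
iter-*-fixed m f fixed (suc k) = trans (iter-+ m (k ℕ.* m) f _) (trans (cong (iter m f) (iter-*-fixed m f fixed k)) fixed)

coprime-periods-fixed : ∀ {A : Set} {m n : ℕ} (f : A → A) {y} → Coprime m n →
                        iter m f y ≡ y → iter n f y ≡ y → f y ≡ y
coprime-periods-fixed {m = m} {n} f {y} coprime m-fixed n-fixed with coprime-Bézout coprime
... | Bézout.+- x z eq = trans (cong f (sym (iter-*-fixed n f n-fixed z)))
                               (trans (cong (λ k → iter k f y) eq) (iter-*-fixed m f m-fixed x))
... | Bézout.-+ x z eq = trans (cong f (sym (iter-*-fixed m f m-fixed x)))
                               (trans (cong (λ k → iter k f y) eq) (iter-*-fixed n f n-fixed z))

orbit : ∀ {A : Set} {n} (f : Fin (suc n) → A) (g : A → A) →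
        (∀ j → f (suc j) ≡ g (f (Fin.inject₁ j))) → ∀ k → f k ≡ iter (toℕ k) g (f zero)
orbit f g step zero = refl
orbit {n = suc n} f g step (suc k) =
  trans (step k) (cong g (orbit (λ j → f (Fin.inject₁ j)) g (λ j → step (Fin.inject₁ j)) k))

module AutomorphismPowers (L : Field) (σ : Automorphism L) where
  open FieldArithmetic L
  open FiniteSums L
  open Automorphism σ using (fun; fun-+; fun-*)

  power : ℕ → Carrier → Carrier
  power n = iter n fun

  fun-0 : fun 0# ≡ 0#
  fun-0 = x+x≈x⇒x≈0 (fun 0#) (sym (trans (cong fun (sym (+-identityʳ 0#))) (fun-+ 0# 0#)))

  fun-injective : ∀ {x y} → fun x ≡ fun y → x ≡ y
  fun-injective {x} {y} e = trans (sym (Automorphism.inv-l σ x)) (trans (cong (Automorphism.inv σ) e) (Automorphism.inv-l σ y))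

  fun-1 : fun 1# ≡ 1#
  fun-1 = *-cancelˡ fun1≢0 (trans (sym (fun-* 1# 1#)) (trans (cong fun (*-identityʳ 1#)) (sym (*-identityʳ _))))
    where
    fun1≢0 : fun 1# ≢ 0#
    fun1≢0 e = 1≢0 (fun-injective (trans e (sym fun-0)))

  power-+ : ∀ n x y → power n (x + y) ≡ power n x + power n y
  power-+ zero    x y = refl
  power-+ (suc n) x y = trans (cong fun (power-+ n x y)) (fun-+ _ _)

  power-* : ∀ n x y → power n (x * y) ≡ power n x * power n y
  power-* zero    x y = refl
  power-* (suc n) x y = trans (cong fun (power-* n x y)) (fun-* _ _)

  power-0 : ∀ n → power n 0# ≡ 0#
  power-0 zero    = refl
  power-0 (suc n) = trans (cong fun (power-0 n)) fun-0

  power-1 : ∀ n → power n 1# ≡ 1#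
  power-1 zero    = refl
  power-1 (suc n) = trans (cong fun (power-1 n)) fun-1

  power-injective : ∀ n {x y} → power n x ≡ power n y → x ≡ y
  power-injective zero    e = e
  power-injective (suc n) e = power-injective n (fun-injective e)

  power-fixed : ∀ n {y} → fun y ≡ y → power n y ≡ y
  power-fixed zero    fixed = refl
  power-fixed (suc n) fixed = trans (cong fun (power-fixed n fixed)) fixed

  power-Σ : ∀ n {m} (f : Fin m → Carrier) → power n (Σ f) ≡ Σ (λ i → power n (f i))
  power-Σ n {zero}  f = power-0 n
  power-Σ n {suc m} f = trans (power-+ n _ _) (cong (power n (f zero) +_) (power-Σ n (λ i → f (suc i))))

  equal-powers⇒period : ∀ m n {x} → m ℕ.< n → power m x ≡ power n x → power (n ℕ.∸ m) x ≡ x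
  equal-powers⇒period m n {x} m<n agree = power-injective m (trans (sym (iter-+ m (n ℕ.∸ m) fun x))
    (trans (cong (λ k → power k x) (ℕP.m+[n∸m]≡n (ℕP.<⇒≤ m<n))) (sym agree)))

module EmbeddingFacts {K L : Field} (ι : Embedding K L) where
  private module K = FieldArithmetic K
  open FieldArithmetic L
  open Embedding ι using (map; map-+; map-*; map-1)

  map-0 : map K.0# ≡ 0#
  map-0 = x+x≈x⇒x≈0 _ (sym (trans (cong map (sym (K.+-identityʳ K.0#))) (map-+ _ _)))

  map-neg : ∀ b → map (K.- b) ≡ - map b
  map-neg b = neg-unique (map b) (map (K.- b)) (trans (sym (map-+ _ _)) (trans (cong map (K.-‿inverseʳ b)) map-0))

  map-injective : DecidableEquality (Field.Carrier K) → ∀ {a b} → map a ≡ map b → a ≡ b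
  map-injective _≟K_ {a} {b} e with (a K.- b) ≟K K.0#
  ... | yes a-b≡0 = K.difference-zero a-b≡0
  ... | no a-b≢0  = ⊥-elim (1≢0 (begin
    1#                                ≡⟨ sym map-1 ⟩
    map K.1#                          ≡⟨ cong map (sym (proj₂ (Field.inverse K _ a-b≢0))) ⟩
    map ((a K.- b) K.* K.inv _ a-b≢0) ≡⟨ map-* _ _ ⟩
    map (a K.- b) * map (K.inv _ a-b≢0) ≡⟨ cong (_* map (K.inv _ a-b≢0)) image-zero ⟩
    0# * map (K.inv _ a-b≢0)          ≡⟨ zeroˡ _ ⟩
    0#                                ∎))
    where
    open ≡-Reasoning
    image-zero : map (a K.- b) ≡ 0#
    image-zero = trans (map-+ _ _) (trans (cong₂ _+_ e (map-neg b)) (-‿inverseʳ (map b)))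

module ImaginaryPoint (t q : ℕ) (K L : Field) (K-size : HasSize K q) (L-size : HasSize L (q ^ t))
                      (ι : Embedding K L) (σ : Automorphism L) (σ-fixes-K : FixesBase ι σ)
                      (P : Vec L t) (imaginary : IsImaginary σ P) where
  _≟_ : DecidableEquality (Field.Carrier L)
  _≟_ = decidable-from-size L-size

  open FieldArithmetic L public
  open FiniteSums L public
  open LinearAlgebra L _≟_ public
  open AutomorphismPowers L σ public
  open EmbeddingFacts ι using (map-injective)
  open Embedding ι using (map)
  open Dedekind L using (dedekind)

  conjugate : Fin t → Vec L t
  conjugate k i = power (toℕ k) (P i)

  conjugates-independent : LinearlyIndependent conjugate
  conjugates-independent = spanning⇒independent conjugate imaginary

  power-fixes-K : ∀ n a → power n (map a) ≡ map a
  power-fixes-K zero    a = refl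
  power-fixes-K (suc n) a = trans (cong (Automorphism.fun σ) (power-fixes-K n a)) (σ-fixes-K a)

  expand : (Fin t → Field.Carrier K) → Carrier
  expand k = Σ (λ i → map (k i) * P i)

  power-expand : ∀ n k → power n (expand k) ≡ Σ (λ i → map (k i) * power n (P i))
  power-expand n k = trans (power-Σ n (λ i → map (k i) * P i))
    (Σ-cong (λ i → trans (power-* n _ _) (cong (_* power n (P i)) (power-fixes-K n (k i)))))

  -- expand is injective: the difference of two preimages is annihilated by every conjugate.
  expand-injective : ∀ k k′ → expand k ≡ expand k′ → ∀ i → k i ≡ k′ i
  expand-injective k k′ e i = map-injective (decidable-from-size K-size)
    (difference-zero (SpanningCoordinates.annihilator-zero conjugate imaginary d annihilated i))
    where
    d : Fin t → Carrier
    d i = map (k i) - map (k′ i)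
    annihilated : ∀ j → Σ (λ i → d i * conjugate j i) ≡ 0#
    annihilated j = begin
      Σ (λ i → d i * conjugate j i)
        ≡⟨ Σ-*-difference (λ i → map (k i)) (λ i → map (k′ i)) (conjugate j) ⟩
      Σ (λ i → map (k i) * conjugate j i) - Σ (λ i → map (k′ i) * conjugate j i)
        ≡⟨ cong₂ _-_ (sym (power-expand (toℕ j) k)) (sym (power-expand (toℕ j) k′)) ⟩
      power (toℕ j) (expand k) - power (toℕ j) (expand k′)
        ≡⟨ cong (λ z → power (toℕ j) (expand k) - power (toℕ j) z) (sym e) ⟩
      power (toℕ j) (expand k) - power (toℕ j) (expand k)
        ≡⟨ -‿inverseʳ _ ⟩
      0# ∎
      where open ≡-Reasoning

  -- Since K^t and L both have q^t elements, expand is onto: reading the elements of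
  -- Fin (q ^ t) as t digits in K makes expand an injection Fin (q ^ t) → L.
  private
    digits : Fin (q ^ t) → Fin t → Field.Carrier K
    digits z i = Inverse.from K-size (finToFun {q} {t} z i)

    expand-digits-injective : Injective _≡_ _≡_ (λ z → expand (digits z))
    expand-digits-injective {z} {z′} e = finToFun-injective {q} {t} z z′
      (λ i → ↔-injective (↔-sym K-size) (expand-injective (digits z) (digits z′) e i))

  expand-surjective : ∀ x → ∃ λ k → expand k ≡ x
  expand-surjective x = digits (proj₁ preimage) , proj₂ preimage
    where
    preimage = onto-by-counting L-size (λ z → expand (digits z)) expand-digits-injective x

  private
    b : Fin t → Carrier
    b = proj₁ (imaginary (λ i → power t (P i)))

    b-spec : ∀ i → power t (P i) ≡ combination b conjugate i
    b-spec = proj₂ (imaginary (λ i → power t (P i)))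

  -- As every element of L is a K-combination of the coordinates of P, the relation
  -- P^{σ^t} = Σⱼ bⱼ P^{σ^j} extends to σ^t = Σⱼ bⱼ σ^j on all of L.
  power-t-combination : ∀ x → power t x ≡ Σ (λ j → b j * power (toℕ j) x)
  power-t-combination x = subst (λ y → power t y ≡ Σ (λ j → b j * power (toℕ j) y))
                                (proj₂ (expand-surjective x)) (on-expansions (proj₁ (expand-surjective x)))
    where
    on-expansions : ∀ k → power t (expand k) ≡ Σ (λ j → b j * power (toℕ j) (expand k))
    on-expansions k = begin
      power t (expand k)                                   ≡⟨ power-expand t k ⟩
      Σ (λ i → map (k i) * power t (P i))                   ≡⟨ Σ-cong (λ i → cong (map (k i) *_) (b-spec i)) ⟩
      Σ (λ i → map (k i) * Σ (λ j → b j * conjugate j i))   ≡⟨ Σ-cong (λ i → cong (map (k i) *_)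
                                                                 (Σ-cong (λ j → *-comm (b j) (conjugate j i)))) ⟩
      Σ (λ i → map (k i) * Σ (λ j → conjugate j i * b j))   ≡⟨ Σ-matrix-assoc (λ i → map (k i)) (λ i j → conjugate j i) b ⟩
      Σ (λ j → Σ (λ i → map (k i) * conjugate j i) * b j)   ≡⟨ Σ-cong (λ j → trans (*-comm _ (b j))
                                                                 (cong (b j *_) (sym (power-expand (toℕ j) k)))) ⟩
      Σ (λ j → b j * power (toℕ j) (expand k))              ∎
      where open ≡-Reasoning

  -- If σ^d = id for some 0 < d ≤ t then d = t, since P^{σ^d} ≠ P for 0 < d < t.
  period⇒order-t : ∀ d → 0 ℕ.< d → d ℕ.≤ t → (∀ x → power d x ≡ x) → ∀ x → power t x ≡ x
  period⇒order-t d 0<d d≤t period with d ℕ.≟ t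
  ... | yes refl = period
  ... | no d≢t   = ⊥-elim (ℕP.<⇒≢ 0<d (sym d≡0))
    where
    d<t : d ℕ.< t
    d<t = ℕP.≤∧≢⇒< d≤t d≢t
    first d-th : Fin t
    first = Fin.fromℕ< (ℕP.≤-<-trans ℕ.z≤n d<t)
    d-th  = Fin.fromℕ< d<t
    same-conjugate : ∀ r → conjugate d-th r ≡ conjugate first r
    same-conjugate r = begin
      power (toℕ d-th) (P r)    ≡⟨ cong (λ n → power n (P r)) (FinP.toℕ-fromℕ< d<t) ⟩
      power d (P r)             ≡⟨ period (P r) ⟩
      P r                       ≡⟨ cong (λ n → power n (P r)) (sym (FinP.toℕ-fromℕ< (ℕP.≤-<-trans ℕ.z≤n d<t))) ⟩
      power (toℕ first) (P r)   ∎
      where open ≡-Reasoning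
    d≡0 : d ≡ 0
    d≡0 = trans (sym (FinP.toℕ-fromℕ< d<t))
                (trans (cong toℕ (independent⇒injective conjugate conjugates-independent same-conjugate))
                       (FinP.toℕ-fromℕ< (ℕP.≤-<-trans ℕ.z≤n d<t)))

  equal-powers⇒order-t : ∀ m n → m ≢ n → m ℕ.≤ t → n ℕ.≤ t → (∀ x → power m x ≡ power n x) → ∀ x → power t x ≡ x
  equal-powers⇒order-t m n m≢n m≤t n≤t agree with ℕP.<-cmp m n
  ... | tri< m<n _ _ = period⇒order-t (n ℕ.∸ m) (ℕP.m<n⇒0<n∸m m<n) (ℕP.≤-trans (ℕP.m∸n≤m n m) n≤t)
                         (λ x → equal-powers⇒period m n m<n (agree x))
  ... | tri≈ _ m≡n _ = ⊥-elim (m≢n m≡n)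
  ... | tri> _ _ n<m = period⇒order-t (m ℕ.∸ n) (ℕP.m<n⇒0<n∸m n<m) (ℕP.≤-trans (ℕP.m∸n≤m m n) m≤t)
                         (λ x → equal-powers⇒period n m n<m (sym (agree x)))

  private
    exponent : Fin (suc t) → ℕ
    exponent zero    = t
    exponent (suc j) = toℕ j

    exponent≤t : ∀ i → exponent i ℕ.≤ t
    exponent≤t zero    = ℕP.≤-refl
    exponent≤t (suc j) = ℕP.<⇒≤ (FinP.toℕ<n j)

    exponent-injective : ∀ {i j} → i ≢ j → exponent i ≢ exponent j
    exponent-injective {zero}  {zero}  i≢j _ = i≢j refl
    exponent-injective {zero}  {suc j} _   e = ℕP.<⇒≢ (FinP.toℕ<n j) (sym e)
    exponent-injective {suc i} {zero}  _   e = ℕP.<⇒≢ (FinP.toℕ<n i) e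
    exponent-injective {suc i} {suc j} i≢j e = i≢j (cong suc (FinP.toℕ-injective e))

  -- σ^t = id: by Dedekind's lemma the maps σ^t, σ^0, …, σ^{t-1}, which
  -- satisfy the relation σ^t = Σⱼ bⱼ σ^j, cannot be pairwise distinct.
  power-t-identity : ∀ x → power t x ≡ x
  power-t-identity with FinP.any? (λ i → FinP.any? (λ j → ¬? (i FinP.≟ j) ×-dec
                          pointwise-equal? L-size _≟_ (power (exponent i)) (power (exponent j))))
  ... | yes (i , j , i≢j , agree) = equal-powers⇒order-t (exponent i) (exponent j) (exponent-injective i≢j)
                                      (exponent≤t i) (exponent≤t j) agree
  ... | no none = ⊥-elim (-1≢0 (dedekind (suc t) χ (λ j → power-* (exponent j) , power-1 (exponent j))
                                  distinct coefficient relation zero))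
    where
    χ : Fin (suc t) → Carrier → Carrier
    χ i = power (exponent i)
    distinct : ∀ i j → i ≢ j → ∃ λ y → χ i y ≢ χ j y
    distinct i j i≢j = differ-somewhere L-size _≟_ (χ i) (χ j) (λ agree → none (i , j , i≢j , agree))
    coefficient : Fin (suc t) → Carrier
    coefficient zero    = - 1#
    coefficient (suc j) = b j
    relation : ∀ x → Σ (λ j → coefficient j * χ j x) ≡ 0#
    relation x = trans (cong (- 1# * power t x +_) (sym (power-t-combination x)))
                       (trans (cong (_+ power t x) (-1*x≈-x _)) (-‿inverseˡ _))

module RationalPoint (t′ q : ℕ) (K L : Field) (K-size : HasSize K q) (L-size : HasSize L (q ^ suc t′))
                     (ι : Embedding K L) (σ : Automorphism L) (σ-fixes-K : FixesBase ι σ)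
                     (P : Vec L (suc t′)) (imaginary : IsImaginary σ P) where
  open ImaginaryPoint (suc t′) q K L K-size L-size ι σ σ-fixes-K P imaginary public
  open Automorphism σ using (fun; fun-*)
  open Embedding ι using (map)

  value : Vec L (suc t′) → Fin (suc t′) → Carrier
  value a k = Σ (λ i → a i * conjugate k i)

  -- The coordinates c of a σ-invariant vector W in the basis of conjugates of P are
  -- the conjugates of c₀: applying σ to W = Σₖ cₖ P^{σ^k} and using σ^t = id shows
  -- that (σ(c_{t-1}), σ(c₀), …, σ(c_{t-2})) are coordinates of W as well.
  module InvariantVector (W : Vec L (suc t′)) (W-invariant : ∀ i → fun (W i) ≡ W i) where
    c : Fin (suc t′) → Carrier
    c = proj₁ (imaginary W)

    c-spec : ∀ i → W i ≡ combination c conjugate i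
    c-spec = proj₂ (imaginary W)

    private
      rotated : Fin (suc t′) → Carrier
      rotated zero    = fun (c (Fin.fromℕ t′))
      rotated (suc j) = fun (c (Fin.inject₁ j))

      rotated-spec : ∀ i → combination rotated conjugate i ≡ W i
      rotated-spec i = sym (begin
        W i                                        ≡⟨ sym (W-invariant i) ⟩
        fun (W i)                                  ≡⟨ cong fun (c-spec i) ⟩
        fun (combination c conjugate i)            ≡⟨ power-Σ 1 (λ k → c k * conjugate k i) ⟩
        Σ (λ k → fun (c k * conjugate k i))        ≡⟨ Σ-cong (λ k → fun-* (c k) (conjugate k i)) ⟩
        Σ (λ k → fun (c k) * fun (conjugate k i))  ≡⟨ Σ-last (λ k → fun (c k) * fun (conjugate k i)) ⟩
        Σ (λ j → fun (c (Fin.inject₁ j)) * fun (conjugate (Fin.inject₁ j) i))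
          + fun (c (Fin.fromℕ t′)) * fun (conjugate (Fin.fromℕ t′) i)
          ≡⟨ cong₂ _+_ (Σ-cong (λ j → cong (λ n → rotated (suc j) * fun (power n (P i))) (FinP.toℕ-inject₁ j)))
                       (cong (rotated zero *_) (trans (cong (λ n → fun (power n (P i))) (FinP.toℕ-fromℕ t′))
                                                      (power-t-identity (P i)))) ⟩
        Σ (λ j → rotated (suc j) * conjugate (suc j) i) + rotated zero * conjugate zero i
          ≡⟨ +-comm _ _ ⟩
        combination rotated conjugate i            ∎)
        where open ≡-Reasoning

      c≡rotated : ∀ k → c k ≡ rotated k
      c≡rotated k = difference-zero (conjugates-independent (λ k → c k - rotated k) (λ r → begin
        combination (λ k → c k - rotated k) conjugate r
          ≡⟨ Σ-*-difference c rotated (λ k → conjugate k r) ⟩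
        combination c conjugate r - combination rotated conjugate r
          ≡⟨ cong₂ _-_ (sym (c-spec r)) (rotated-spec r) ⟩
        W r - W r
          ≡⟨ -‿inverseʳ _ ⟩
        0# ∎) k)
        where open ≡-Reasoning

    c-conjugates : ∀ k → c k ≡ power (toℕ k) (c zero)
    c-conjugates = orbit c fun (λ j → c≡rotated (suc j))

    c≢0 : Nonzero L W → ∀ k → c k ≢ 0#
    c≢0 W≢0 k ck≡0 = W≢0 (λ i → trans (c-spec i) (Σ-zero (λ j → trans (cong (_* conjugate j i) (c-zero j)) (zeroˡ _))))
      where
      c₀≡0 : c zero ≡ 0#
      c₀≡0 = power-injective (toℕ k) (trans (sym (c-conjugates k)) (trans ck≡0 (sym (power-0 (toℕ k)))))
      c-zero : ∀ j → c j ≡ 0#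
      c-zero j = trans (c-conjugates j) (trans (cong (power (toℕ j)) c₀≡0) (power-0 (toℕ j)))

    vanishing-form : ∀ a → Σ (λ i → a i * W i) ≡ 0# → Σ (λ k → c k * value a k) ≡ 0#
    vanishing-form a aW≡0 = begin
      Σ (λ k → c k * Σ (λ i → a i * conjugate k i))   ≡⟨ Σ-cong (λ k → cong (c k *_) (Σ-cong (λ i → *-comm (a i) (conjugate k i)))) ⟩
      Σ (λ k → c k * Σ (λ i → conjugate k i * a i))   ≡⟨ Σ-matrix-assoc c conjugate a ⟩
      Σ (λ i → combination c conjugate i * a i)       ≡⟨ Σ-cong (λ i → trans (cong (_* a i) (sym (c-spec i))) (*-comm _ _)) ⟩
      Σ (λ i → a i * W i)                             ≡⟨ aW≡0 ⟩
      0#                                              ∎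
      where open ≡-Reasoning

  -- A nonzero rational point Q = λ ι(w): its coordinates are those of the σ-invariant
  -- vector ι(w).
  module RationalCoordinates (Q : Vec L (suc t′)) (Q≢0 : Nonzero L Q) (rational : IsRational ι Q) where
    w : Fin (suc t′) → Field.Carrier K
    w = proj₁ rational
    λ₀ : Carrier
    λ₀ = proj₁ (proj₂ rational)
    λ₀≢0 : λ₀ ≢ 0#
    λ₀≢0 = proj₁ (proj₂ (proj₂ rational))
    Q-spec : ∀ i → Q i ≡ λ₀ * map (w i)
    Q-spec = proj₂ (proj₂ (proj₂ rational))

    open InvariantVector (λ i → map (w i)) (λ i → σ-fixes-K (w i)) public

    coordinates≢0 : ∀ k → c k ≢ 0#
    coordinates≢0 = c≢0 (λ W≡0 → Q≢0 (λ i → trans (Q-spec i) (trans (cong (λ₀ *_) (W≡0 i)) (zeroʳ λ₀))))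

    on-hyperplane : ∀ a → OnHyperplane L a Q → Σ (λ k → c k * value a k) ≡ 0#
    on-hyperplane a aQ≡0 = vanishing-form a (no-zero-divisor λ₀≢0 (trans (sym (Σ-*ˡ λ₀ (λ i → a i * map (w i))))
      (trans (Σ-cong (λ i → trans (solve 3 (λ Λ A X → Λ :* (A :* X) := A :* (Λ :* X)) refl λ₀ (a i) (map (w i)))
                                  (cong (a i *_) (sym (Q-spec i))))) aQ≡0)))

  equal-conjugates⇒fixed : Prime (suc t′) → ∀ m n {y} → m ℕ.< n → n ℕ.< suc t′ →
                           power m y ≡ power n y → fun y ≡ y
  equal-conjugates⇒fixed t-prime m n {y} m<n n<t agree =
    coprime-periods-fixed fun (prime⇒coprime t-prime {{ℕ.>-nonZero (ℕP.m<n⇒0<n∸m m<n)}} n-m<t)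
                          (power-t-identity y) (equal-powers⇒period m n m<n agree)
    where
    n-m<t : n ℕ.∸ m ℕ.< suc t′
    n-m<t = ℕP.≤-<-trans (ℕP.m∸n≤m n m) n<t

  -- Otherwise y = c₀/d₀ has two equal conjugates,
  -- so it is fixed by σ, and then c = y d makes Q₁ and Q₂ proportional.
  module TwoRationalPoints (t-prime : Prime (suc t′)) (Q₁ Q₂ : Vec L (suc t′))
                           (Q₁≢0 : Nonzero L Q₁) (Q₂≢0 : Nonzero L Q₂)
                           (Q₁-rational : IsRational ι Q₁) (Q₂-rational : IsRational ι Q₂)
                           (Q₁≢Q₂ : ¬ SamePoint L Q₁ Q₂) where
    module R₁ = RationalCoordinates Q₁ Q₁≢0 Q₁-rational
    module R₂ = RationalCoordinates Q₂ Q₂≢0 Q₂-rational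
    c d : Fin (suc t′) → Carrier
    c = R₁.c
    d = R₂.c

    private
      d₀⁻¹ : Carrier
      d₀⁻¹ = inv (d zero) (R₂.coordinates≢0 zero)

      y : Carrier
      y = c zero * d₀⁻¹

      c₀≡yd₀ : c zero ≡ y * d zero
      c₀≡yd₀ = sym (trans (*-assoc _ _ _) (trans (cong (c zero *_) (inv-l _ (R₂.coordinates≢0 zero))) (*-identityʳ _)))

      c≡y-conjugate*d : ∀ k → c k ≡ power (toℕ k) y * d k
      c≡y-conjugate*d k = begin
        c k                                         ≡⟨ R₁.c-conjugates k ⟩
        power (toℕ k) (c zero)                      ≡⟨ cong (power (toℕ k)) c₀≡yd₀ ⟩
        power (toℕ k) (y * d zero)                  ≡⟨ power-* (toℕ k) y (d zero) ⟩
        power (toℕ k) y * power (toℕ k) (d zero)    ≡⟨ cong (power (toℕ k) y *_) (sym (R₂.c-conjugates k)) ⟩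
        power (toℕ k) y * d k                       ∎
        where open ≡-Reasoning

      fixed-ratio⇒same-point : fun y ≡ y → SamePoint L Q₁ Q₂
      fixed-ratio⇒same-point y-fixed = κ , κ≢0 , Q₁≡κQ₂
        where
        W₁≡yW₂ : ∀ i → map (R₁.w i) ≡ y * map (R₂.w i)
        W₁≡yW₂ i = begin
          map (R₁.w i)                          ≡⟨ R₁.c-spec i ⟩
          combination c conjugate i             ≡⟨ Σ-cong (λ k → trans (cong (_* conjugate k i)
                                                     (trans (c≡y-conjugate*d k) (cong (_* d k) (power-fixed (toℕ k) y-fixed))))
                                                     (*-assoc _ _ _)) ⟩
          Σ (λ k → y * (d k * conjugate k i))   ≡⟨ Σ-*ˡ y (λ k → d k * conjugate k i) ⟩
          y * combination d conjugate i         ≡⟨ cong (y *_) (sym (R₂.c-spec i)) ⟩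
          y * map (R₂.w i)                      ∎
          where open ≡-Reasoning
        λ₂⁻¹ : Carrier
        λ₂⁻¹ = inv R₂.λ₀ R₂.λ₀≢0
        κ : Carrier
        κ = (R₁.λ₀ * y) * λ₂⁻¹
        y≢0 : y ≢ 0#
        y≢0 y≡0 = R₁.coordinates≢0 zero (trans c₀≡yd₀ (trans (cong (_* d zero) y≡0) (zeroˡ _)))
        κ≢0 : κ ≢ 0#
        κ≢0 = *-≢0 (*-≢0 R₁.λ₀≢0 y≢0) (inv≢0 R₂.λ₀ R₂.λ₀≢0)
        Q₁≡κQ₂ : ∀ i → Q₁ i ≡ κ * Q₂ i
        Q₁≡κQ₂ i = begin
          Q₁ i                                          ≡⟨ R₁.Q-spec i ⟩
          R₁.λ₀ * map (R₁.w i)                          ≡⟨ cong (R₁.λ₀ *_) (W₁≡yW₂ i) ⟩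
          R₁.λ₀ * (y * map (R₂.w i))                    ≡⟨ sym (*-identityʳ _) ⟩
          R₁.λ₀ * (y * map (R₂.w i)) * 1#               ≡⟨ cong (R₁.λ₀ * (y * map (R₂.w i)) *_) (sym (inv-l R₂.λ₀ R₂.λ₀≢0)) ⟩
          R₁.λ₀ * (y * map (R₂.w i)) * (λ₂⁻¹ * R₂.λ₀)  ≡⟨ solve 5 (λ Λ Y X I M → Λ :* (Y :* X) :* (I :* M) := ((Λ :* Y) :* I) :* (M :* X))
                                                               refl R₁.λ₀ y (map (R₂.w i)) λ₂⁻¹ R₂.λ₀ ⟩
          κ * (R₂.λ₀ * map (R₂.w i))                    ≡⟨ cong (κ *_) (sym (R₂.Q-spec i)) ⟩
          κ * Q₂ i                                      ∎
          where open ≡-Reasoning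

      minor≢0-< : ∀ i j → toℕ i ℕ.< toℕ j → c i * d j ≢ c j * d i
      minor≢0-< i j i<j minor≡0 = Q₁≢Q₂ (fixed-ratio⇒same-point
        (equal-conjugates⇒fixed t-prime (toℕ i) (toℕ j) i<j (FinP.toℕ<n j) (*-cancelˡ dd≢0 (begin
          (d i * d j) * power (toℕ i) y   ≡⟨ solve 3 (λ A B Y → (A :* B) :* Y := (Y :* A) :* B) refl (d i) (d j) _ ⟩
          (power (toℕ i) y * d i) * d j   ≡⟨ cong (_* d j) (sym (c≡y-conjugate*d i)) ⟩
          c i * d j                       ≡⟨ minor≡0 ⟩
          c j * d i                       ≡⟨ cong (_* d i) (c≡y-conjugate*d j) ⟩
          (power (toℕ j) y * d j) * d i   ≡⟨ solve 3 (λ A B Y → (Y :* B) :* A := (A :* B) :* Y) refl (d i) (d j) _ ⟩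
          (d i * d j) * power (toℕ j) y   ∎))))
        where
        open ≡-Reasoning
        dd≢0 : d i * d j ≢ 0#
        dd≢0 = *-≢0 (R₂.coordinates≢0 i) (R₂.coordinates≢0 j)

    minor≢0 : ∀ i j → i ≢ j → c i * d j ≢ c j * d i
    minor≢0 i j i≢j with ℕP.<-cmp (toℕ i) (toℕ j)
    ... | tri< i<j _ _ = minor≢0-< i j i<j
    ... | tri≈ _ e _   = ⊥-elim (i≢j (FinP.toℕ-injective e))
    ... | tri> _ _ j<i = λ minor≡0 → minor≢0-< j i j<i (sym minor≡0)

  module Hyperplane (t-prime : Prime (suc t′)) (Q₁ Q₂ : Vec L (suc t′))
                    (Q₁≢0 : Nonzero L Q₁) (Q₂≢0 : Nonzero L Q₂)
                    (Q₁-rational : IsRational ι Q₁) (Q₂-rational : IsRational ι Q₂)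
                    (Q₁≢Q₂ : ¬ SamePoint L Q₁ Q₂) (a : Vec L (suc t′))
                    (s : Fin (suc t′) → Fin (suc (suc (suc t′)))) (s-injective : Injective _≡_ _≡_ s)
                    (on : ∀ j → OnHyperplane L a (pointList σ Q₁ Q₂ P (s j))) where
    open TwoRationalPoints t-prime Q₁ Q₂ Q₁≢0 Q₂≢0 Q₁-rational Q₂-rational Q₁≢Q₂ public

    -- The values of a at the points; the conjugate P^{σ^k} has index k + 2.
    V : Fin (suc (suc (suc t′))) → Carrier
    V x = Σ (λ i → a i * pointList σ Q₁ Q₂ P x i)

    f : Fin (suc t′) → Carrier
    f = value a

    Off : Fin (suc (suc (suc t′))) → Set
    Off x = V x ≢ 0#

    P-index-injective : ∀ {k j} → k ≢ j → Fin.suc {suc (suc t′)} (suc k) ≢ suc (suc j)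
    P-index-injective k≢j e = k≢j (FinP.suc-injective (FinP.suc-injective e))

    -- At most two of the points are off the hyperplane, since s misses only two indices.
    on-unless-two-off : ∀ x y z → x ≢ y → x ≢ z → y ≢ z → Off x → Off y → V z ≡ 0#
    on-unless-two-off x y z x≢y x≢z y≢z x-off y-off = decidable-stable (V z ≟ 0#) (λ z-off →
      misses-at-most-two s s-injective x y z x≢y x≢z y≢z (missed x-off) (missed y-off) (missed z-off))
      where
      missed : ∀ {x} → Off x → ∀ j → s j ≢ x
      missed x-off j e = x-off (subst (λ x → V x ≡ 0#) e (on j))

    f-zero-off : ∀ x i₀ → (∀ k → x ≢ suc (suc k)) → Off x → f i₀ ≢ 0# → ∀ k → k ≢ i₀ → f k ≡ 0#
    f-zero-off x i₀ x-not-P x-off fi₀≢0 k k≢i₀ =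
      on-unless-two-off x (suc (suc i₀)) (suc (suc k)) (x-not-P i₀) (x-not-P k)
                        (P-index-injective (λ e → k≢i₀ (sym e))) x-off fi₀≢0

    -- Q₁ off: then Q₂ is on, and a vanishes at all conjugates but P^{σ^{i₀}}, which
    -- contradicts Σₖ dₖ fₖ = 0.
    Q₁-off-impossible : ∀ i₀ → f i₀ ≢ 0# → Off zero → ⊥
    Q₁-off-impossible i₀ fi₀≢0 Q₁-off = single-term≢0 d f i₀ (f-zero-off zero i₀ (λ _ ()) Q₁-off fi₀≢0)
      (R₂.coordinates≢0 i₀) fi₀≢0
      (R₂.on-hyperplane a (on-unless-two-off zero (suc (suc i₀)) (suc zero) (λ ()) (λ ()) (λ ()) Q₁-off fi₀≢0))

    -- Symmetrically, Q₂ off contradicts Σₖ cₖ fₖ = 0.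
    Q₂-off-impossible : ∀ i₀ → f i₀ ≢ 0# → Off (suc zero) → ⊥
    Q₂-off-impossible i₀ fi₀≢0 Q₂-off = single-term≢0 c f i₀ (f-zero-off (suc zero) i₀ (λ _ ()) Q₂-off fi₀≢0)
      (R₁.coordinates≢0 i₀) fi₀≢0
      (R₁.on-hyperplane a (on-unless-two-off (suc zero) (suc (suc i₀)) zero (λ ()) (λ ()) (λ ()) Q₂-off fi₀≢0))

    -- Both Q₁ and Q₂ on: Σ c f = 0 forces a second conjugate P^{σ^j} off the
    -- hyperplane, so f is supported on {i₀, j} and the minor cᵢ₀ dⱼ - cⱼ dᵢ₀ vanishes.
    both-on-impossible : ∀ i₀ → f i₀ ≢ 0# → V zero ≡ 0# → V (suc zero) ≡ 0# → ⊥
    both-on-impossible i₀ fi₀≢0 Q₁-on Q₂-on with zero-or-nonzero-entry (λ j → f (punchIn i₀ j))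
    ... | inj₁ rest-zero = single-term≢0 c f i₀ off-i₀ (R₁.coordinates≢0 i₀) fi₀≢0 (R₁.on-hyperplane a Q₁-on)
      where
      off-i₀ : ∀ k → k ≢ i₀ → f k ≡ 0#
      off-i₀ k k≢i₀ = trans (cong f (sym (FinP.punchIn-punchOut (λ e → k≢i₀ (sym e))))) (rest-zero _)
    ... | inj₂ (j , fj≢0) = minor≢0 i₀ (punchIn i₀ j) i₀≢j
      (two-term-minor c d f i₀ (punchIn i₀ j) i₀≢j off-two fi₀≢0 (R₁.on-hyperplane a Q₁-on) (R₂.on-hyperplane a Q₂-on))
      where
      i₀≢j : i₀ ≢ punchIn i₀ j
      i₀≢j e = FinP.punchInᵢ≢i i₀ j (sym e)
      off-two : ∀ k → k ≢ i₀ → k ≢ punchIn i₀ j → f k ≡ 0#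
      off-two k k≢i₀ k≢j = on-unless-two-off (suc (suc i₀)) (suc (suc (punchIn i₀ j))) (suc (suc k))
        (P-index-injective i₀≢j) (P-index-injective (λ e → k≢i₀ (sym e))) (P-index-injective (λ e → k≢j (sym e)))
        fi₀≢0 fj≢0

-- Proposition 3.3. Writing t = suc t′ (t ≥ 3): the nonzero form a takes a nonzero
-- value at some conjugate P^{σ^{i₀}}, as these span L^t; so that point is off the
-- hyperplane, and each of the three possibilities for Q₁ and Q₂ is refuted.
proposition3p3 :
    (t : ℕ) → Prime t → 3 ≤ t →
    (q : ℕ) → (K L : Field) → HasSize K q → HasSize L (q ^ t) →
    (ι : Embedding K L) → (σ : Automorphism L) → IsGaloisGenerator ι σ →
    (Q₁ Q₂ P : Vec L t) →
    Nonzero L Q₁ → Nonzero L Q₂ → IsRational ι Q₁ → IsRational ι Q₂ →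
    ¬ SamePoint L Q₁ Q₂ →
    Nonzero L P → IsImaginary σ P →
    (s : Fin t → Fin (suc (suc t))) → Injective _≡_ _≡_ s →
    ¬ (∃ λ (a : Vec L t) → Nonzero L a ×
         (∀ (j : Fin t) → OnHyperplane L a (pointList σ Q₁ Q₂ P (s j))))
proposition3p3 zero _ ()
proposition3p3 (suc t′) t-prime _ q K L K-size L-size ι σ (σ-fixes-K , _) Q₁ Q₂ P Q₁≢0 Q₂≢0
               Q₁-rational Q₂-rational Q₁≢Q₂ _ imaginary s s-injective (a , a≢0 , on) =
  case zero-or-nonzero-entry f of λ where
    (inj₁ f≡0) → a≢0 (SpanningCoordinates.annihilator-zero conjugate imaginary a f≡0)
    (inj₂ (i₀ , fi₀≢0)) → case V zero ≟ 0# of λ where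
      (no Q₁-off) → Q₁-off-impossible i₀ fi₀≢0 Q₁-off
      (yes Q₁-on) → case V (suc zero) ≟ 0# of λ where
        (no Q₂-off) → Q₂-off-impossible i₀ fi₀≢0 Q₂-off
        (yes Q₂-on) → both-on-impossible i₀ fi₀≢0 Q₁-on Q₂-on
  where
  open RationalPoint t′ q K L K-size L-size ι σ σ-fixes-K P imaginary
  open Hyperplane t-prime Q₁ Q₂ Q₁≢0 Q₂≢0 Q₁-rational Q₂-rational Q₁≢Q₂ a s s-injective on
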